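{- Let $G$ be a finite undirected graph that is prime and $P_5$-free, and suppose $G$ is not a thin spider. Then every efficient dominating set of $G$ has exactly two vertices.
   Context: All graphs are finite, simple and undirected. A vertex dominates itself and its neighbors. A set $D \subseteq V(G)$ is an efficient dominating set (e.d.) of $G$ if every vertex of $G$ is dominated by exactly one vertex of $D$. $P_5$ denotes the chordless (induced) path on five vertices; $G$ is $P_5$-free if it has no induced subgraph isomorphic to $P_5$. A set $H$ of at least two vertices of $G$ is homogeneous if $H \neq V(G)$ and every vertex outside $H$ is adjacent either to all vertices of $H$ or to none of them; $G$ is prime if it has no homogeneous set. A thin spider is a split graph whose vertex set is partitioned into a clique $C$ and an independent set $I$ such that every vertex of $C$ has exactly one neighbor in $I$ and every vertex of $I$ has exactly one neighbor in $C$. -}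

module Defs where

open import Data.Nat using (ℕ; _≤_; _∸_; _+_)
open import Data.Fin using (Fin; toℕ)
open import Data.Fin.Subset using (Subset; _∈_; _∉_; ∣_∣)
open import Data.Product using (Σ; ∃; _×_; _,_)
open import Data.Sum using (_⊎_)
open import Relation.Nullary using (¬_)
open import Relation.Binary.PropositionalEquality using (_≡_)
open import Function.Definitions using (Injective)

record Graph (n : ℕ) : Set₁ where
  field
    Adj   : Fin n → Fin n → Set
    sym   : ∀ {u v} → Adj u v → Adj v u
    irrefl : ∀ {u} → ¬ Adj u u

open Graph public

module _ {n : ℕ} (G : Graph n) where

  Dominates : Fin n → Fin n → Set
  Dominates v u = v ≡ u ⊎ Adj G v u

  EfficientDominatingSet : Subset n → Set
  EfficientDominatingSet D =
    ∀ u → (∃ λ v → v ∈ D × Dominates v u)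
        × (∀ v w → v ∈ D → w ∈ D → Dominates v u → Dominates w u → v ≡ w)

  Consecutive : Fin 5 → Fin 5 → Set
  Consecutive i j = (toℕ i ∸ toℕ j) + (toℕ j ∸ toℕ i) ≡ 1

  InducedP5 : Set
  InducedP5 = Σ (Fin 5 → Fin n) λ f →
    Injective _≡_ _≡_ f
    × (∀ i j → (Adj G (f i) (f j) → Consecutive i j)
             × (Consecutive i j → Adj G (f i) (f j)))

  P5Free : Set
  P5Free = ¬ InducedP5

  Homogeneous : Subset n → Set
  Homogeneous H =
    2 ≤ ∣ H ∣
    × (∃ λ x → x ∉ H)
    × (∀ x → x ∉ H → (∀ h → h ∈ H → Adj G x h) ⊎ (∀ h → h ∈ H → ¬ Adj G x h))

  Prime : Set
  Prime = ∀ H → ¬ Homogeneous H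



  ThinSpider : Set
  ThinSpider = Σ (Subset n) λ C →
    (∀ u v → u ∈ C → v ∈ C → ¬ u ≡ v → Adj G u v)
    × (∀ u v → u ∉ C → v ∉ C → ¬ Adj G u v)
    × (∀ c → c ∈ C → ∃ λ i → i ∉ C × Adj G c i × (∀ i' → i' ∉ C → Adj G c i' → i' ≡ i))
    × (∀ i → i ∉ C → ∃ λ c → c ∈ C × Adj G i c × (∀ c' → c' ∈ C → Adj G i c' → c' ≡ c))

-- Write dom u for the vertex of D dominating u; the fibres of dom partition the vertices into
-- classes. Paths of the form d – x – y – z – d' through two dominators show that, in a P5-free graph,
-- adjacency between vertices outside D is transitive across three distinct classes, and that a
-- classmate of an endpoint of a cross-class edge must see that edge. When |D| ≥ 3, combining this
-- with primality (each time by exhibiting a homogeneous set) shows that the vertices outside D in one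
-- class have the same neighbours in the other classes, hence that every class has exactly one vertex
-- outside D, that these vertices form a clique, and that every d ∈ D has a neighbour. So V ∖ D is a
-- clique perfectly matched to the independent set D: G is a thin spider. When |D| = 1 the vertices
-- outside D form a homogeneous set unless there is only one of them, and then G = K₂ is a thin spider;
-- |D| = 0 is impossible. Hence |D| = 2.
-- Adjacency is not assumed decidable, but since |D| ≡ 2 is, the argument may run under a double
-- negation, in which excluded middle for adjacency is available.

module Submission where

open import Defs hiding (sym)
open import Data.Nat using (ℕ; zero; suc; _≤_; _<_; _+_; z≤n; s≤s)
import Data.Nat as ℕ
open import Data.Nat.Properties using (≤-trans; ≤-reflexive; +-suc; +-monoʳ-≤; <⇒≱)
open import Data.Fin using (Fin; zero; suc; fromℕ<)
open import Data.Fin.Patterns using (0F; 1F; 2F; 3F; 4F)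
open import Data.Fin.Properties using (any?; all?; _≟_)
open import Data.Fin.Subset using (Subset; _⊆_; _∈_; _∉_; ∣_∣; ⁅_⁆; _∪_; ⊤; ∁; inside; outside)
open import Data.Fin.Subset.Properties
  using ( _∈?_; p⊆q⇒∣p∣≤∣q∣; ∣⁅x⁆∣≡1; ∣⊤∣≡n; x∈⁅x⁆; x∈p∪q⁺; ∣p∣≤∣x∷p∣
        ; x∈p∧x≢y⇒x∈p-y; x∈p⇒∣p-x∣<∣p∣; x∈p⇒x∉∁p; x∈∁p⇒x∉p; x∉p⇒x∈∁p; x∉∁p⇒x∈p; x∉⁅y⁆⇒x≢y)
open import Data.Vec.Base using ([]; _∷_; lookup; tabulate)
open import Data.Vec.Properties using (lookup∘tabulate; []=⇒lookup; lookup⇒[]=)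
open import Data.Product using (∃; _×_; _,_; proj₁; proj₂)
open import Data.Sum using (_⊎_; inj₁; inj₂)
import Data.Sum as Sum
import Data.Empty as Empty
open import Function using (_∘_; _$_)
open import Function.Definitions using (Injective)
open import Relation.Nullary using (¬_; Dec; yes; no; does; contradiction)
open import Relation.Nullary.Decidable
  using (decidable-stable; dec-true; from-yes; _×-dec_; _⊎-dec_; _→-dec_; ¬?; ¬¬-excluded-middle)
import Relation.Unary as U
import Relation.Binary as B
open import Relation.Binary.PropositionalEquality using (_≡_; _≢_; refl; sym; trans; subst; cong₂)

-- Finite sets

¬¬-∀-Fin : ∀ {n} {P : Fin n → Set} → (∀ x → ¬ ¬ P x) → ¬ ¬ (∀ x → P x)
¬¬-∀-Fin {zero} _ k = k λ ()
¬¬-∀-Fin {suc n} ¬¬P k =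
  ¬¬P zero λ P0 → ¬¬-∀-Fin (¬¬P ∘ suc) λ Psuc → k λ { zero → P0 ; (suc x) → Psuc x }

toSubset : ∀ {n} {P : Fin n → Set} → U.Decidable P → Subset n
toSubset P? = tabulate (does ∘ P?)

∈toSubset⁺ : ∀ {n} {P : Fin n → Set} (P? : U.Decidable P) {x} → P x → x ∈ toSubset P?
∈toSubset⁺ P? {x} Px = lookup⇒[]= x _ (trans (lookup∘tabulate _ x) (dec-true (P? x) Px))

∈toSubset⁻ : ∀ {n} {P : Fin n → Set} (P? : U.Decidable P) {x} → x ∈ toSubset P? → P x
∈toSubset⁻ P? {x} x∈P with P? x | trans (sym (lookup∘tabulate _ x)) ([]=⇒lookup x∈P)
... | yes Px | _ = Px
... | no _   | ()

∣p∪q∣≤∣p∣+∣q∣ : ∀ {n} (p q : Subset n) → ∣ p ∪ q ∣ ≤ ∣ p ∣ + ∣ q ∣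
∣p∪q∣≤∣p∣+∣q∣ []            []            = z≤n
∣p∪q∣≤∣p∣+∣q∣ (outside ∷ p) (outside ∷ q) = ∣p∪q∣≤∣p∣+∣q∣ p q
∣p∪q∣≤∣p∣+∣q∣ (outside ∷ p) (inside ∷ q)  =
  ≤-trans (s≤s (∣p∪q∣≤∣p∣+∣q∣ p q)) (≤-reflexive (sym (+-suc ∣ p ∣ ∣ q ∣)))
∣p∪q∣≤∣p∣+∣q∣ (inside ∷ p)  (s ∷ q)       =
  s≤s (≤-trans (∣p∪q∣≤∣p∣+∣q∣ p q) (+-monoʳ-≤ ∣ p ∣ (∣p∣≤∣x∷p∣ s q)))

∈∈⇒2≤∣p∣ : ∀ {n} {p : Subset n} {x y} → x ∈ p → y ∈ p → x ≢ y → 2 ≤ ∣ p ∣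
∈∈⇒2≤∣p∣ x∈p y∈p x≢y =
  ≤-trans (s≤s (≤-trans (s≤s z≤n) (x∈p⇒∣p-x∣<∣p∣ (x∈p∧x≢y⇒x∈p-y y∈p (x≢y ∘ sym)))))
          (x∈p⇒∣p-x∣<∣p∣ x∈p)

∃-∈-∉ : ∀ {n} {p q : Subset n} → ∣ q ∣ < ∣ p ∣ → ∃ λ x → x ∈ p × x ∉ q
∃-∈-∉ {p = p} {q} ∣q∣<∣p∣ with any? (λ x → (x ∈? p) ×-dec ¬? (x ∈? q))
... | yes witness = witness
... | no none = contradiction (p⊆q⇒∣p∣≤∣q∣ p⊆q) (<⇒≱ ∣q∣<∣p∣)
  where
  p⊆q : p ⊆ q
  p⊆q {x} x∈p = decidable-stable (x ∈? q) (λ x∉q → none (x , x∈p , x∉q))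

∃-∉ : ∀ {n} (q : Subset n) → ∣ q ∣ < n → ∃ λ x → x ∉ q
∃-∉ {n} q ∣q∣<n with ∃-∈-∉ {p = ⊤} {q} (subst (∣ q ∣ <_) (sym (∣⊤∣≡n n)) ∣q∣<n)
... | x , _ , x∉q = x , x∉q

∃-∈-≢₂ : ∀ {n} {p : Subset n} → 3 ≤ ∣ p ∣ → ∀ a b → ∃ λ c → c ∈ p × c ≢ a × c ≢ b
∃-∈-≢₂ {p = p} 3≤∣p∣ a b with ∃-∈-∉ {p = p} {⁅ a ⁆ ∪ ⁅ b ⁆} (≤-trans (s≤s ∣a,b∣≤2) 3≤∣p∣)
  where
  ∣a,b∣≤2 : ∣ ⁅ a ⁆ ∪ ⁅ b ⁆ ∣ ≤ 2
  ∣a,b∣≤2 = ≤-trans (∣p∪q∣≤∣p∣+∣q∣ ⁅ a ⁆ ⁅ b ⁆) (≤-reflexive (cong₂ _+_ (∣⁅x⁆∣≡1 a) (∣⁅x⁆∣≡1 b)))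
... | c , c∈p , c∉ab = c , c∈p , c∉ab ∘ x∈p∪q⁺ ∘ inj₁ ∘ ∈⁅⁆ , c∉ab ∘ x∈p∪q⁺ ∘ inj₂ ∘ ∈⁅⁆
  where
  ∈⁅⁆ : ∀ {x y} → x ≡ y → x ∈ ⁅ y ⁆
  ∈⁅⁆ refl = x∈⁅x⁆ _

-- Graphs and induced paths

module _ {n} (G : Graph n) where

  adj⇒≢ : ∀ {u v} → Adj G u v → u ≢ v
  adj⇒≢ uv refl = irrefl G uv

  NoSplitter : (Fin n → Set) → Set
  NoSplitter P = ∀ v → ¬ P v → (∀ h → P h → Adj G v h) ⊎ (∀ h → P h → ¬ Adj G v h)

  consecutive? : ∀ i j → Dec (Consecutive G i j)
  consecutive? i j = _ ℕ.≟ 1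

  P5-neighbourhoods-differ : ∀ i j → i ≡ j
    ⊎ (∃ λ k → Consecutive G i k × ¬ Consecutive G j k)
    ⊎ (∃ λ k → Consecutive G j k × ¬ Consecutive G i k)
  P5-neighbourhoods-differ = from-yes (all? λ i → all? λ j → (i ≟ j)
    ⊎-dec any? (λ k → consecutive? i k ×-dec ¬? (consecutive? j k))
    ⊎-dec any? (λ k → consecutive? j k ×-dec ¬? (consecutive? i k)))

  inducedP5 : ∀ {a b c d e} → Adj G a b → Adj G b c → Adj G c d → Adj G d e →
              ¬ Adj G a c → ¬ Adj G a d → ¬ Adj G a e → ¬ Adj G b d → ¬ Adj G b e → ¬ Adj G c e →
              InducedP5 G
  inducedP5 {a} {b} {c} {d} {e} ab bc cd de ¬ac ¬ad ¬ae ¬bd ¬be ¬ce =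
    f , f-injective , λ i j → sound (matches i j) , complete (matches i j)
    where
    f : Fin 5 → Fin n
    f = lookup (a ∷ b ∷ c ∷ d ∷ e ∷ [])

    record Matches (i j : Fin 5) : Set where
      field
        sound    : Adj G (f i) (f j) → Consecutive G i j
        complete : Consecutive G i j → Adj G (f i) (f j)
    open Matches

    edge : ∀ {i j} → Consecutive G i j → Adj G (f i) (f j) → Matches i j
    edge c a = record { sound = λ _ → c ; complete = λ _ → a }

    nonEdge : ∀ {i j} → ¬ Consecutive G i j → ¬ Adj G (f i) (f j) → Matches i j
    nonEdge ¬c ¬a = record { sound = Empty.⊥-elim ∘ ¬a ; complete = Empty.⊥-elim ∘ ¬c }

    flip¬ : ∀ {u v} → ¬ Adj G u v → ¬ Adj G v u
    flip¬ ¬uv = ¬uv ∘ Graph.sym G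

    matches : ∀ i j → Matches i j
    matches 0F 0F = nonEdge (λ ()) (irrefl G)
    matches 0F 1F = edge refl ab
    matches 0F 2F = nonEdge (λ ()) ¬ac
    matches 0F 3F = nonEdge (λ ()) ¬ad
    matches 0F 4F = nonEdge (λ ()) ¬ae
    matches 1F 0F = edge refl (Graph.sym G ab)
    matches 1F 1F = nonEdge (λ ()) (irrefl G)
    matches 1F 2F = edge refl bc
    matches 1F 3F = nonEdge (λ ()) ¬bd
    matches 1F 4F = nonEdge (λ ()) ¬be
    matches 2F 0F = nonEdge (λ ()) (flip¬ ¬ac)
    matches 2F 1F = edge refl (Graph.sym G bc)
    matches 2F 2F = nonEdge (λ ()) (irrefl G)
    matches 2F 3F = edge refl cd
    matches 2F 4F = nonEdge (λ ()) ¬ce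
    matches 3F 0F = nonEdge (λ ()) (flip¬ ¬ad)
    matches 3F 1F = nonEdge (λ ()) (flip¬ ¬bd)
    matches 3F 2F = edge refl (Graph.sym G cd)
    matches 3F 3F = nonEdge (λ ()) (irrefl G)
    matches 3F 4F = edge refl de
    matches 4F 0F = nonEdge (λ ()) (flip¬ ¬ae)
    matches 4F 1F = nonEdge (λ ()) (flip¬ ¬be)
    matches 4F 2F = nonEdge (λ ()) (flip¬ ¬ce)
    matches 4F 3F = edge refl (Graph.sym G de)
    matches 4F 4F = nonEdge (λ ()) (irrefl G)

    ≡-image⇒consecutive : ∀ i j k → f i ≡ f j → Consecutive G i k → Consecutive G j k
    ≡-image⇒consecutive i j k fi≡fj ik =
      sound (matches j k) (subst (λ v → Adj G v (f k)) fi≡fj (complete (matches i k) ik))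

    f-injective : Injective _≡_ _≡_ f
    f-injective {i} {j} fi≡fj with P5-neighbourhoods-differ i j
    ... | inj₁ i≡j = i≡j
    ... | inj₂ (inj₁ (k , ik , ¬jk)) = contradiction (≡-image⇒consecutive i j k fi≡fj ik) ¬jk
    ... | inj₂ (inj₂ (k , jk , ¬ik)) = contradiction (≡-image⇒consecutive j i k (sym fi≡fj) jk) ¬ik

module _ {n} (G : Graph n) (prime : Prime G) where

  no-homogeneous-set : ∀ {P : Fin n → Set} → U.Decidable P → ∀ {x y z} →
                       P x → P y → x ≢ y → ¬ P z → ¬ NoSplitter G P
  no-homogeneous-set {P} P? {x} {y} {z} Px Py x≢y ¬Pz noSplitter =
    prime H (∈∈⇒2≤∣p∣ (∈H Px) (∈H Py) x≢y , (z , ¬Pz ∘ ∈toSubset⁻ P?) , homogeneous)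
    where
    H : Subset n
    H = toSubset P?

    ∈H : ∀ {v} → P v → v ∈ H
    ∈H = ∈toSubset⁺ P?

    homogeneous : ∀ v → v ∉ H → (∀ h → h ∈ H → Adj G v h) ⊎ (∀ h → h ∈ H → ¬ Adj G v h)
    homogeneous v v∉H = Sum.map (λ all h → all h ∘ ∈toSubset⁻ P?) (λ none h → none h ∘ ∈toSubset⁻ P?)
                                (noSplitter v (v∉H ∘ ∈H))

  prime⇒neighbour : B.Decidable (Adj G) → ∀ {v x y} → x ≢ v → y ≢ v → x ≢ y → ∃ (Adj G v)
  prime⇒neighbour adj? {v} x≢v y≢v x≢y with any? (adj? v)
  ... | yes neighbour = neighbour
  ... | no isolated = Empty.⊥-elim $
    no-homogeneous-set (¬? ∘ (_≟ v)) x≢v y≢v x≢y (λ v≢v → v≢v refl) λ u ¬u≢v →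
      inj₂ λ h _ uh → isolated (h , subst (λ w → Adj G w h) (decidable-stable (u ≟ v) ¬u≢v) uh)

-- Efficient dominating sets

module EfficientDomination {n} (G : Graph n) {D : Subset n} (ed : EfficientDominatingSet G D) where

  dom : Fin n → Fin n
  dom u = proj₁ (proj₁ (ed u))

  dom∈D : ∀ u → dom u ∈ D
  dom∈D u = proj₁ (proj₂ (proj₁ (ed u)))

  dom-unique : ∀ {u d} → d ∈ D → Dominates G d u → dom u ≡ d
  dom-unique {u} d∈D d↦u = proj₂ (ed u) _ _ (dom∈D u) d∈D (proj₂ (proj₂ (proj₁ (ed u)))) d↦u

  dom-self : ∀ {d} → d ∈ D → dom d ≡ d
  dom-self d∈D = dom-unique d∈D (inj₁ refl)

  dom-neighbour : ∀ {u d} → d ∈ D → Adj G u d → dom u ≡ d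
  dom-neighbour d∈D ud = dom-unique d∈D (inj₂ (Graph.sym G ud))

  adj-dom : ∀ {u} → u ∉ D → Adj G u (dom u)
  adj-dom {u} u∉D with proj₂ (proj₂ (proj₁ (ed u)))
  ... | inj₁ dom≡u = contradiction (subst (_∈ D) dom≡u (dom∈D u)) u∉D
  ... | inj₂ dom-u = Graph.sym G dom-u

  adj-∈D⇒dom≡ : ∀ {u v} → Adj G u v → v ∈ D → dom u ≡ dom v
  adj-∈D⇒dom≡ uv v∈D = trans (dom-neighbour v∈D uv) (sym (dom-self v∈D))

  ¬adj-dom : ∀ {u x} → dom u ≢ dom x → ¬ Adj G u (dom x)
  ¬adj-dom u≢x u-dx = u≢x (dom-neighbour (dom∈D _) u-dx)

  D-independent : ∀ {d e} → d ∈ D → e ∈ D → ¬ Adj G d e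
  D-independent d∈D e∈D de = adj⇒≢ G de (trans (sym (dom-self d∈D)) (dom-neighbour e∈D de))

-- Efficient dominating sets in prime P5-free graphs

module PrimeP5Free {n} (G : Graph n) (adj? : B.Decidable (Adj G)) (prime : Prime G) (p5-free : P5Free G)
                   {D : Subset n} (ed : EfficientDominatingSet G D) where
  open EfficientDomination G ed

  classmate-adjacent : ∀ {w x y} → w ∉ D → x ∉ D → y ∉ D → dom w ≡ dom x → dom x ≢ dom y →
                       Adj G x y → ¬ Adj G w y → Adj G w x
  classmate-adjacent {w} {x} {y} w∉D x∉D y∉D [w]≡[x] [x]≢[y] xy ¬wy = decidable-stable (adj? w x) λ ¬wx →
    p5-free (inducedP5 G (subst (Adj G w) [w]≡[x] (adj-dom w∉D)) (Graph.sym G (adj-dom x∉D)) xy (adj-dom y∉D)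
      ¬wx ¬wy (¬adj-dom ([x]≢[y] ∘ trans (sym [w]≡[x]))) (¬adj-dom ([x]≢[y] ∘ sym) ∘ Graph.sym G)
      (D-independent (dom∈D x) (dom∈D y)) (¬adj-dom [x]≢[y]))

  cross-class-trans : ∀ {x y z} → x ∉ D → z ∉ D → dom x ≢ dom y → dom y ≢ dom z → dom x ≢ dom z →
                      Adj G x y → Adj G y z → Adj G x z
  cross-class-trans {x} {y} {z} x∉D z∉D [x]≢[y] [y]≢[z] [x]≢[z] xy yz = decidable-stable (adj? x z) λ ¬xz →
    p5-free (inducedP5 G (Graph.sym G (adj-dom x∉D)) xy yz (adj-dom z∉D)
      (¬adj-dom ([x]≢[y] ∘ sym) ∘ Graph.sym G) (¬adj-dom ([x]≢[z] ∘ sym) ∘ Graph.sym G)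
      (D-independent (dom∈D x) (dom∈D z)) ¬xz (¬adj-dom [x]≢[z]) (¬adj-dom [y]≢[z]))

  AtMostOneOutsider : Set
  AtMostOneOutsider = ∀ {x y} → x ∉ D → y ∉ D → dom x ≡ dom y → x ≡ y

  -- If u ≁ v, the classes of u and of its neighbours outside D form a homogeneous set avoiding v.
  ∉D-adjacent : AtMostOneOutsider → ∀ {u v} → u ∉ D → v ∉ D → u ≢ v → Adj G u v
  ∉D-adjacent unique {u} {v} u∉D v∉D u≢v = decidable-stable (adj? u v) λ ¬uv →
    no-homogeneous-set G prime K? (inj₁ refl) (inj₁ (dom-self (dom∈D u))) (adj⇒≢ G (adj-dom u∉D))
      (¬Kv ¬uv) noSplitter
    where
    K : Fin n → Set
    K w = dom w ≡ dom u ⊎ ∃ λ t → t ∉ D × dom t ≡ dom w × Adj G u t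

    K? : U.Decidable K
    K? w = (dom w ≟ dom u) ⊎-dec any? (λ t → ¬? (t ∈? D) ×-dec (dom t ≟ dom w) ×-dec adj? u t)

    ¬Kv : ¬ Adj G u v → ¬ K v
    ¬Kv ¬uv (inj₁ [v]≡[u]) = u≢v (unique u∉D v∉D (sym [v]≡[u]))
    ¬Kv ¬uv (inj₂ (t , t∉D , [t]≡[v] , ut)) = ¬uv (subst (Adj G u) (unique t∉D v∉D [t]≡[v]) ut)

    K-class : ∀ {w h} → dom w ≡ dom h → K h → K w
    K-class [w]≡[h] (inj₁ [h]≡[u]) = inj₁ (trans [w]≡[h] [h]≡[u])
    K-class [w]≡[h] (inj₂ (t , t∉D , [t]≡[h] , ut)) = inj₂ (t , t∉D , trans [t]≡[h] (sym [w]≡[h]) , ut)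

    noSplitter : NoSplitter G K
    noSplitter w ¬Kw = inj₂ λ h Kh wh → ¬Kw (K-neighbour h Kh wh)
      where
      K-neighbour : ∀ h → K h → Adj G w h → K w
      K-neighbour h Kh wh with w ∈? D | h ∈? D
      ... | yes w∈D | _ = K-class (sym (adj-∈D⇒dom≡ (Graph.sym G wh) w∈D)) Kh
      ... | no _ | yes h∈D = K-class (adj-∈D⇒dom≡ wh h∈D) Kh
      ... | no w∉D | no h∉D with dom h ≟ dom u
      ...   | yes [h]≡[u] =
              inj₂ (w , w∉D , refl , subst (λ x → Adj G x w) (unique h∉D u∉D [h]≡[u]) (Graph.sym G wh))
      ...   | no [h]≢[u] with dom w ≟ dom h | Kh
      ...     | yes [w]≡[h] | _ = K-class [w]≡[h] Kh
      ...     | no _ | inj₁ [h]≡[u] = contradiction [h]≡[u] [h]≢[u]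
      ...     | no [w]≢[h] | inj₂ (t , t∉D , [t]≡[h] , ut) = inj₂ (w , w∉D , refl ,
                  cross-class-trans u∉D w∉D ([h]≢[u] ∘ sym) ([w]≢[h] ∘ sym) (¬Kw ∘ inj₁ ∘ sym)
                    (subst (Adj G u) (unique t∉D h∉D [t]≡[h]) ut) (Graph.sym G wh))

  thinSpider : AtMostOneOutsider → (∀ {d} → d ∈ D → ∃ (Adj G d)) → ThinSpider G
  thinSpider unique has-neighbour = ∁ D , clique , independent , outsider-matched , inside-matched
    where
    clique : ∀ u v → u ∈ ∁ D → v ∈ ∁ D → u ≢ v → Adj G u v
    clique u v u∈C v∈C = ∉D-adjacent unique (x∈∁p⇒x∉p u∈C) (x∈∁p⇒x∉p v∈C)

    independent : ∀ u v → u ∉ ∁ D → v ∉ ∁ D → ¬ Adj G u v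
    independent u v u∉C v∉C = D-independent (x∉∁p⇒x∈p u∉C) (x∉∁p⇒x∈p v∉C)

    outsider-matched : ∀ c → c ∈ ∁ D → ∃ λ i → i ∉ ∁ D × Adj G c i × (∀ i' → i' ∉ ∁ D → Adj G c i' → i' ≡ i)
    outsider-matched c c∈C = dom c , x∈p⇒x∉∁p (dom∈D c) , adj-dom (x∈∁p⇒x∉p c∈C) ,
      λ i' i'∉C ci' → sym (dom-neighbour (x∉∁p⇒x∈p i'∉C) ci')

    inside-matched : ∀ i → i ∉ ∁ D → ∃ λ c → c ∈ ∁ D × Adj G i c × (∀ c' → c' ∈ ∁ D → Adj G i c' → c' ≡ c)
    inside-matched i i∉C with has-neighbour (x∉∁p⇒x∈p i∉C)
    ... | c , ic = c , x∉p⇒x∈∁p c∉D , ic ,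
        λ c' c'∈C ic' → unique (x∈∁p⇒x∉p c'∈C) c∉D
          (trans (dom-neighbour i∈D (Graph.sym G ic')) (sym (dom-neighbour i∈D (Graph.sym G ic))))
      where
      i∈D : i ∈ D
      i∈D = x∉∁p⇒x∈p i∉C

      c∉D : c ∉ D
      c∉D c∈D = D-independent i∈D c∈D ic

  ClassUniform : Set
  ClassUniform = ∀ {x x' y} → x ∉ D → x' ∉ D → y ∉ D → dom x ≡ dom x' → dom x ≢ dom y →
                 Adj G x y → Adj G x' y

  atMostOneOutsider : ClassUniform → AtMostOneOutsider
  atMostOneOutsider uniform {x} {x'} x∉D x'∉D [x]≡[x'] = decidable-stable (x ≟ x') λ x≢x' →
    no-homogeneous-set G prime H? (x∉D , refl) (x'∉D , sym [x]≡[x']) x≢x' (λ (d∉D , _) → d∉D (dom∈D x))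
      noSplitter
    where
    H : Fin n → Set
    H v = v ∉ D × dom v ≡ dom x

    H? : U.Decidable H
    H? v = ¬? (v ∈? D) ×-dec (dom v ≟ dom x)

    noSplitter : NoSplitter G H
    noSplitter v ¬Hv with v ∈? D
    ... | yes v∈D with v ≟ dom x
    ...   | yes refl = inj₁ λ h (h∉D , [h]≡[x]) → Graph.sym G (subst (Adj G h) [h]≡[x] (adj-dom h∉D))
    ...   | no v≢d = inj₂ λ h (_ , [h]≡[x]) vh →
              v≢d (trans (sym (dom-neighbour v∈D (Graph.sym G vh))) [h]≡[x])
    noSplitter v ¬Hv | no v∉D with any? (λ h → H? h ×-dec adj? v h)
    ... | yes (h₀ , (h₀∉D , [h₀]≡[x]) , vh₀) = inj₁ λ h (h∉D , [h]≡[x]) →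
            Graph.sym G (uniform h₀∉D h∉D v∉D (trans [h₀]≡[x] (sym [h]≡[x]))
              (λ [h₀]≡[v] → ¬Hv (v∉D , trans (sym [h₀]≡[v]) [h₀]≡[x])) (Graph.sym G vh₀))
    ... | no none = inj₂ λ h Hh vh → none (h , Hh , vh)

  Local : Fin n → Set
  Local w = ∀ y → Adj G w y → dom w ≡ dom y

  foreign-or-local : ∀ w → (∃ λ y → Adj G w y × dom w ≢ dom y) ⊎ Local w
  foreign-or-local w with any? (λ y → adj? w y ×-dec ¬? (dom w ≟ dom y))
  ... | yes foreign = inj₁ foreign
  ... | no none = inj₂ λ y wy → decidable-stable (dom w ≟ dom y) λ [w]≢[y] → none (y , wy , [w]≢[y])

  ∈D⇒local : ∀ {d} → d ∈ D → Local d
  ∈D⇒local d∈D y dy = sym (adj-∈D⇒dom≡ (Graph.sym G dy) d∈D)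

  foreign-∉D : ∀ {x y} → Adj G x y → dom x ≢ dom y → y ∉ D
  foreign-∉D xy [x]≢[y] = [x]≢[y] ∘ adj-∈D⇒dom≡ xy

  neighbour-of-classmate : ∀ {c h p q} → c ∉ D → h ∉ D → p ∉ D → q ∉ D →
    dom h ≡ dom p → dom p ≢ dom q → dom c ≢ dom h → dom c ≢ dom q →
    Adj G p q → Adj G c h → ¬ Adj G c q → Adj G c p
  neighbour-of-classmate {c} {h} {p} {q} c∉D h∉D p∉D q∉D [h]≡[p] [p]≢[q] [c]≢[h] [c]≢[q] pq ch ¬cq =
    decidable-stable (adj? c p) λ ¬cp →
    p5-free (inducedP5 G ch hp pq (adj-dom q∉D) ¬cp ¬cq (¬adj-dom [c]≢[q]) ¬hq
      (¬adj-dom ([p]≢[q] ∘ trans (sym [h]≡[p]))) (¬adj-dom [p]≢[q]))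
    where
    ¬hq : ¬ Adj G h q
    ¬hq hq = ¬cq (cross-class-trans c∉D q∉D [c]≢[h] ([p]≢[q] ∘ trans (sym [h]≡[p])) [c]≢[q] ch hq)
    hp : Adj G h p
    hp = classmate-adjacent h∉D p∉D q∉D [h]≡[p] [p]≢[q] pq ¬hq

  module ThreeDominators (third : ∀ a b → ∃ λ c → c ∈ D × c ≢ a × c ≢ b) where

    foreign-neighbour : ∀ {x} → x ∉ D → ∃ λ y → Adj G x y × dom x ≢ dom y
    foreign-neighbour {x} x∉D with foreign-or-local x
    ... | inj₁ foreign = foreign
    ... | inj₂ x-local with third (dom x) (dom x)
    ... | e , e∈D , e≢d , _ = Empty.⊥-elim $
      no-homogeneous-set G prime S? {x} {dom x} (refl , x-local) (dom-self d∈D , ∈D⇒local d∈D)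
        (adj⇒≢ G (adj-dom x∉D)) (λ ([e]≡[x] , _) → e≢d (trans (sym (dom-self e∈D)) [e]≡[x])) noSplitter
      where
      d∈D : dom x ∈ D
      d∈D = dom∈D x

      S : Fin n → Set
      S w = dom w ≡ dom x × Local w

      S? : U.Decidable S
      S? w = (dom w ≟ dom x) ×-dec all? (λ y → adj? w y →-dec (dom w ≟ dom y))

      noSplitter : NoSplitter G S
      noSplitter v ¬Sv with dom v ≟ dom x
      ... | no [v]≢[x] = inj₂ λ h ([h]≡[x] , h-local) vh →
              [v]≢[x] (trans (sym (h-local v (Graph.sym G vh))) [h]≡[x])
      ... | yes [v]≡[x] with v ∈? D | foreign-or-local v
      ...   | yes v∈D | _ = contradiction ([v]≡[x] , ∈D⇒local v∈D) ¬Sv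
      ...   | no _ | inj₂ v-local = contradiction ([v]≡[x] , v-local) ¬Sv
      ...   | no v∉D | inj₁ (y , vy , [v]≢[y]) = inj₁ adjacent
        where
        adjacent : ∀ h → S h → Adj G v h
        adjacent h ([h]≡[x] , h-local) with h ∈? D
        ... | yes h∈D = subst (Adj G v) (trans [v]≡[x] (trans (sym [h]≡[x]) (dom-self h∈D))) (adj-dom v∉D)
        ... | no h∉D = Graph.sym G (classmate-adjacent h∉D v∉D (foreign-∉D vy [v]≢[y])
                  (trans [h]≡[x] (sym [v]≡[x])) [v]≢[y] vy
                  λ hy → [v]≢[y] (trans [v]≡[x] (trans (sym [h]≡[x]) (h-local y hy))))

    foreign-neighbours-in-class : ∀ {a a' b z} → a ∉ D → a' ∉ D → b ∉ D → dom a ≡ dom a' → dom a ≢ dom b →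
      Adj G a b → ¬ Adj G a' b → Adj G a' z → dom a' ≢ dom z → dom z ≡ dom b
    foreign-neighbours-in-class {a} {a'} {b} {z} a∉D a'∉D b∉D [a]≡[a'] [a]≢[b] ab ¬a'b a'z [a']≢[z] =
      decidable-stable (dom z ≟ dom b) (p5-free ∘ induced-path)
      where
      z∉D : z ∉ D
      z∉D = foreign-∉D a'z [a']≢[z]

      [a]≢[z] : dom a ≢ dom z
      [a]≢[z] = [a']≢[z] ∘ trans (sym [a]≡[a'])

      [b]≢[a'] : dom b ≢ dom a'
      [b]≢[a'] [b]≡[a'] = [a]≢[b] (trans [a]≡[a'] (sym [b]≡[a']))

      aa' : Adj G a a'
      aa' = Graph.sym G (classmate-adjacent a'∉D a∉D b∉D (sym [a]≡[a']) [a]≢[b] ab ¬a'b)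

      induced-path : dom z ≢ dom b → InducedP5 G
      induced-path [z]≢[b] = inducedP5 G (Graph.sym G (adj-dom b∉D)) (Graph.sym G ab) aa' a'z
        (¬adj-dom [a]≢[b] ∘ Graph.sym G) (¬adj-dom ([b]≢[a'] ∘ sym) ∘ Graph.sym G)
        (¬adj-dom [z]≢[b] ∘ Graph.sym G) (¬a'b ∘ Graph.sym G) ¬bz ¬az
        where
        ¬bz : ¬ Adj G b z
        ¬bz bz = ¬a'b (Graph.sym G
          (cross-class-trans b∉D a'∉D ([z]≢[b] ∘ sym) ([a']≢[z] ∘ sym) [b]≢[a'] bz (Graph.sym G a'z)))

        ¬az : ¬ Adj G a z
        ¬az az = ¬bz (cross-class-trans b∉D z∉D ([a]≢[b] ∘ sym) [a]≢[z] ([z]≢[b] ∘ sym) (Graph.sym G ab) az)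

    -- A missing edge x'y confines the foreign neighbours of y to the class of x (y-foreign), which makes
    -- the union W of the classes of x and y a homogeneous set.
    class-uniform : ClassUniform
    class-uniform {x} {x'} {y} x∉D x'∉D y∉D [x]≡[x'] [x]≢[y] xy
      with foreign-neighbour x'∉D | third (dom x) (dom y)
    ... | z , x'z , [x']≢[z] | e , e∈D , e≢dx , e≢dy = decidable-stable (adj? x' y) W-homogeneous
      where
      W : Fin n → Set
      W c = dom c ≡ dom x ⊎ dom c ≡ dom y

      W? : U.Decidable W
      W? c = (dom c ≟ dom x) ⊎-dec (dom c ≟ dom y)

      ¬We : ¬ W e
      ¬We (inj₁ [e]≡[x]) = e≢dx (trans (sym (dom-self e∈D)) [e]≡[x])
      ¬We (inj₂ [e]≡[y]) = e≢dy (trans (sym (dom-self e∈D)) [e]≡[y])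

      W-homogeneous : ¬ Adj G x' y → Empty.⊥
      W-homogeneous ¬x'y =
        no-homogeneous-set G prime W? (inj₁ (dom-self (dom∈D x))) (inj₂ (dom-self (dom∈D y))) [x]≢[y]
          ¬We noSplitter
        where
        y-foreign : ∀ {w} → Adj G y w → dom y ≢ dom w → dom w ≡ dom x'
        y-foreign = foreign-neighbours-in-class (foreign-∉D x'z [x']≢[z]) y∉D x'∉D
          (foreign-neighbours-in-class x∉D x'∉D y∉D [x]≡[x'] [x]≢[y] xy ¬x'y x'z [x']≢[z])
          ([x']≢[z] ∘ sym) (Graph.sym G x'z) (¬x'y ∘ Graph.sym G)

        no-neighbour : ∀ c → ¬ W c → ∀ h → W h → ¬ Adj G c h
        no-neighbour c ¬Wc h Wh ch = Sum.[ in-class-x , in-class-y ] Wh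
          where
          [c]≢[x] : dom c ≢ dom x
          [c]≢[x] = ¬Wc ∘ inj₁

          [c]≢[y] : dom c ≢ dom y
          [c]≢[y] = ¬Wc ∘ inj₂

          [c]≢[h] : dom c ≢ dom h
          [c]≢[h] [c]≡[h] = ¬Wc (Sum.map (trans [c]≡[h]) (trans [c]≡[h]) Wh)

          c∉D : c ∉ D
          c∉D = foreign-∉D (Graph.sym G ch) ([c]≢[h] ∘ sym)

          h∉D : h ∉ D
          h∉D = foreign-∉D ch [c]≢[h]

          ¬cy : ¬ Adj G c y
          ¬cy cy = [c]≢[x] (trans (y-foreign (Graph.sym G cy) ([c]≢[y] ∘ sym)) (sym [x]≡[x']))

          ¬cx : ¬ Adj G c x
          ¬cx cx = ¬cy (cross-class-trans c∉D y∉D [c]≢[x] [x]≢[y] [c]≢[y] cx xy)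

          in-class-x : dom h ≡ dom x → Empty.⊥
          in-class-x [h]≡[x] =
            ¬cx (neighbour-of-classmate c∉D h∉D x∉D y∉D [h]≡[x] [x]≢[y] [c]≢[h] [c]≢[y] xy ch ¬cy)

          in-class-y : dom h ≡ dom y → Empty.⊥
          in-class-y [h]≡[y] = ¬cy (neighbour-of-classmate c∉D h∉D y∉D x∉D [h]≡[y] ([x]≢[y] ∘ sym)
                                      [c]≢[h] [c]≢[x] (Graph.sym G xy) ch ¬cx)

        noSplitter : NoSplitter G W
        noSplitter c ¬Wc = inj₂ (no-neighbour c ¬Wc)

    has-neighbour : ∀ {d} → d ∈ D → ∃ (Adj G d)
    has-neighbour {d} _ with third d d
    ... | e , _ , e≢d , _ with third d e
    ... | e' , _ , e'≢d , e'≢e = prime⇒neighbour G prime adj? e≢d e'≢d (e'≢e ∘ sym)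

  thinSpider-≥3 : 3 ≤ ∣ D ∣ → ThinSpider G
  thinSpider-≥3 3≤∣D∣ = thinSpider (atMostOneOutsider class-uniform) has-neighbour
    where open ThreeDominators (∃-∈-≢₂ 3≤∣D∣)

  thinSpider-singleton : (∀ {d e} → d ∈ D → e ∈ D → d ≡ e) → (∀ v → ∃ λ u → u ≢ v) → ThinSpider G
  thinSpider-singleton D-singleton other = thinSpider (atMostOneOutsider uniform) has-neighbour
    where
    uniform : ClassUniform
    uniform {x} {y = y} _ _ _ _ [x]≢[y] _ = contradiction (D-singleton (dom∈D x) (dom∈D y)) [x]≢[y]

    has-neighbour : ∀ {d} → d ∈ D → ∃ (Adj G d)
    has-neighbour {d} d∈D with other d
    ... | u , u≢d = u , Graph.sym G (subst (Adj G u) (D-singleton (dom∈D u) d∈D) (adj-dom u∉D))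
      where
      u∉D : u ∉ D
      u∉D u∈D = u≢d (D-singleton u∈D d∈D)

  thinSpider-unless-two : 2 ≤ n → ∣ D ∣ ≢ 2 → ThinSpider G
  thinSpider-unless-two 2≤n ∣D∣≢2 = by-size ∣ D ∣ refl
    where
    by-size : ∀ k → ∣ D ∣ ≡ k → ThinSpider G
    by-size 0 ∣D∣≡0 = contradiction (≤-trans (x∈p⇒∣p-x∣<∣p∣ (dom∈D v)) (≤-reflexive ∣D∣≡0)) λ ()
      where
      v : Fin n
      v = fromℕ< (≤-trans (s≤s z≤n) 2≤n)
    by-size 1 ∣D∣≡1 = thinSpider-singleton D-singleton other
      where
      D-singleton : ∀ {d e} → d ∈ D → e ∈ D → d ≡ e
      D-singleton d∈D e∈D = decidable-stable (_ ≟ _) λ d≢e →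
        contradiction (subst (2 ≤_) ∣D∣≡1 (∈∈⇒2≤∣p∣ d∈D e∈D d≢e)) λ { (s≤s ()) }
      other : ∀ v → ∃ λ u → u ≢ v
      other v with ∃-∉ ⁅ v ⁆ (subst (_< n) (sym (∣⁅x⁆∣≡1 v)) 2≤n)
      ... | u , u∉⁅v⁆ = u , x∉⁅y⁆⇒x≢y u∉⁅v⁆
    by-size 2 ∣D∣≡2 = contradiction ∣D∣≡2 ∣D∣≢2
    by-size (suc (suc (suc _))) ∣D∣≡3+k = thinSpider-≥3 (subst (3 ≤_) (sym ∣D∣≡3+k) (s≤s (s≤s (s≤s z≤n))))

lemma1 : ∀ {n : ℕ} → 2 ≤ n → (G : Graph n) → Prime G → P5Free G → ¬ ThinSpider G →
         ∀ (D : Subset n) → EfficientDominatingSet G D → ∣ D ∣ ≡ 2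
lemma1 2≤n G prime p5-free ¬spider D ed =
  decidable-stable (∣ D ∣ ℕ.≟ 2) λ ∣D∣≢2 →
  ¬¬-∀-Fin (λ u → ¬¬-∀-Fin λ v → ¬¬-excluded-middle) λ adj? →
  ¬spider (PrimeP5Free.thinSpider-unless-two G adj? prime p5-free ed 2≤n ∣D∣≢2)
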